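{- Let $n\geq 4$ and let $G\in\mathcal{GAQ}_n$ be a generalized augmented cube. Let $(a,b)$ be an edge of $G$, let $A$ be the set of neighbors of $a$ and let $B$ be the set of neighbors of $b$. Then $A\setminus\{b\}\neq B\setminus\{a\}$.
   Context: The $n$-dimensional augmented cube $AQ_n$ ($n\geq 1$) has vertex set the $n$-bit binary strings. $AQ_1\cong K_2$ on $\{0,1\}$. For $n\geq 2$, take two copies of $AQ_{n-1}$, prefix the vertices of one copy with $0$ (call it $AQ^0_{n-1}$) and of the other with $1$ (call it $AQ^1_{n-1}$); a vertex $u=0u_1\cdots u_{n-1}$ and a vertex $v=1v_1\cdots v_{n-1}$ are adjacent iff either $u_i=v_i$ for all $i\geq 1$ (a cross edge) or $u_i\neq v_i$ for all $i\geq1$ (a complement edge). Generalized augmented cubes: $\mathcal{GAQ}_4=\{AQ_4\}$; for $n\geq 5$, $\mathcal{GAQ}_n$ consists of all graphs $(V_1\cup V_2, E_1\cup E_2\cup M_1\cup M_2)$ where $G_1=(V_1,E_1)$ and $G_2=(V_2,E_2)$ are graphs in $\mathcal{GAQ}_{n-1}$ (not necessarily distinct up to isomorphism) on disjoint vertex sets, and $M_1,M_2$ are edge-disjoint perfect matchings between $V_1$ and $V_2$. A generalized augmented cube is a member of $\mathcal{GAQ}_n$ for some $n\geq 4$. -}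

module Defs where

open import Data.Nat using (ℕ; zero; suc)
open import Data.Bool using (Bool; true; false; not)
open import Data.Vec using (Vec; []; _∷_; map)
open import Data.Sum using (_⊎_)
open import Data.Product using (_×_)
open import Relation.Binary.PropositionalEquality using (_≡_; _≢_)
open import Function.Bundles using (_↔_; Inverse)
open import Level using (0ℓ) renaming (suc to lsuc)

Graph : ℕ → Set₁
Graph n = Vec Bool n → Vec Bool n → Set

-- The augmented cube AQ_n (n ≥ 1), by the recursive definition.
-- AQ 0 is a dummy (the empty graph on the single empty string); it is never used.
AQ : (n : ℕ) → Graph n
AQ zero _ _ = Data.Empty.⊥ where import Data.Empty
AQ (suc zero) (x ∷ []) (y ∷ []) = x ≢ y
AQ (suc (suc n)) (false ∷ u) (false ∷ v) = AQ (suc n) u v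
AQ (suc (suc n)) (true  ∷ u) (true  ∷ v) = AQ (suc n) u v
AQ (suc (suc n)) (false ∷ u) (true  ∷ v) = (u ≡ v) ⊎ (u ≡ map not v)
AQ (suc (suc n)) (true  ∷ u) (false ∷ v) = (u ≡ v) ⊎ (u ≡ map not v)

-- Gluing two graphs G₁ (on the 0-prefixed copy) and G₂ (on the 1-prefixed copy)
-- together with two perfect matchings M₁, M₂ between the copies, given as
-- bijections: 0x is matched to 1(M x).
glue : {n : ℕ} → Graph n → Graph n →
       (Vec Bool n ↔ Vec Bool n) → (Vec Bool n ↔ Vec Bool n) → Graph (suc n)
glue G₁ G₂ M₁ M₂ (false ∷ u) (false ∷ v) = G₁ u v
glue G₁ G₂ M₁ M₂ (true  ∷ u) (true  ∷ v) = G₂ u v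
glue G₁ G₂ M₁ M₂ (false ∷ u) (true  ∷ v) = (Inverse.to M₁ u ≡ v) ⊎ (Inverse.to M₂ u ≡ v)
glue G₁ G₂ M₁ M₂ (true  ∷ u) (false ∷ v) = (Inverse.to M₁ v ≡ u) ⊎ (Inverse.to M₂ v ≡ u)

-- Membership in the class 𝒢𝒜𝒬_n (up to relabelling the vertex set as n-bit strings,
-- the first bit recording which of the two copies a vertex lies in).
data IsGAQ : (n : ℕ) → Graph n → Set₁ where
  base : IsGAQ 4 (AQ 4)
  step : ∀ {n} {G₁ G₂ : Graph n} → IsGAQ n G₁ → IsGAQ n G₂ →
         (M₁ M₂ : Vec Bool n ↔ Vec Bool n) →
         (∀ u → Inverse.to M₁ u ≢ Inverse.to M₂ u) →
         IsGAQ (suc n) (glue G₁ G₂ M₁ M₂)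

-- Two adjacent vertices a, b with N(a) - {b} = N(b) - {a} are "twins". In AQ₄ a finite
-- check finds a neighbour of a that is neither b nor adjacent to b. Gluing two graphs
-- with two perfect matchings preserves the absence of adjacent twins: inside one copy
-- the twin condition restricts to that copy, and for a cross edge (a, b) the at least
-- two neighbours of a in its own copy would all have to be neighbours of b as well,
-- giving b three distinct neighbours in the other copy, while b has only two there,
-- one per matching.
module Submission where

open import Defs
open import Data.Nat using (ℕ; zero; suc)
open import Data.Bool using (Bool; true; false; not)
import Data.Bool.Properties as Bool
open import Data.Vec using (Vec; []; _∷_; map)
open import Data.Vec.Properties using (≡-dec; ∷-injectiveˡ; ∷-injectiveʳ; map-∘; map-cong; map-id)
open import Data.Product using (_×_; _,_; proj₁; ∃; ∃₂; map₂)
open import Data.Sum using (_⊎_; inj₁; inj₂)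
open import Data.Empty using (⊥)
open import Level using (Level)
open import Function using (_∘_; id)
open import Function.Bundles using (_⇔_; _↔_; Inverse; mk⇔; Equivalence)
import Function.Properties.Equivalence as ⇔
open import Relation.Nullary using (¬_; Dec; no)
open import Relation.Nullary.Decidable using (map′; _×-dec_; _⊎-dec_; _→-dec_; ¬?; toWitness)
open import Relation.Unary using (Pred; Decidable)
open import Relation.Binary.PropositionalEquality using (_≡_; _≢_; refl; sym; trans; cong; module ≡-Reasoning)

private
  variable
    n : ℕ

Twins : Graph n → Vec Bool n → Vec Bool n → Set
Twins G a b = ∀ x → (G a x × x ≢ b) ⇔ (G b x × x ≢ a)

Twins-sym : {G : Graph n} {a b : Vec Bool n} → Twins G a b → Twins G b a
Twins-sym twins = ⇔.sym ∘ twins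

distinguishing-neighbour⇒¬Twins : {G : Graph n} {a b : Vec Bool n} →
                                  (∃ λ x → G a x × x ≢ b × ¬ G b x) → ¬ Twins G a b
distinguishing-neighbour⇒¬Twins (x , ax , x≢b , ¬bx) twins =
  ¬bx (proj₁ (Equivalence.to (twins x) (ax , x≢b)))

Twins-copy : (H : Graph (suc n)) (c : Bool) {u v : Vec Bool n} →
             Twins H (c ∷ u) (c ∷ v) → Twins (λ x y → H (c ∷ x) (c ∷ y)) u v
Twins-copy H c twins x =
  mk⇔ (transfer (Equivalence.to (twins (c ∷ x)))) (transfer (Equivalence.from (twins (c ∷ x))))
  where
  transfer : {P Q : Set} {w w′ : Vec Bool _} →
             (P × c ∷ x ≢ c ∷ w → Q × c ∷ x ≢ c ∷ w′) → P × x ≢ w → Q × x ≢ w′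
  transfer f = map₂ (_∘ cong (c ∷_)) ∘ f ∘ map₂ (_∘ ∷-injectiveʳ)

three-distinct-not-in-pair : {A : Set} {p q x y z : A} → x ≢ y → x ≢ z → y ≢ z →
                             x ≡ p ⊎ x ≡ q → y ≡ p ⊎ y ≡ q → z ≡ p ⊎ z ≡ q → ⊥
three-distinct-not-in-pair x≢y _ _ (inj₁ x≡p) (inj₁ y≡p) _ = x≢y (trans x≡p (sym y≡p))
three-distinct-not-in-pair x≢y _ _ (inj₂ x≡q) (inj₂ y≡q) _ = x≢y (trans x≡q (sym y≡q))
three-distinct-not-in-pair _ x≢z _ (inj₁ x≡p) _ (inj₁ z≡p) = x≢z (trans x≡p (sym z≡p))
three-distinct-not-in-pair _ x≢z _ (inj₂ x≡q) _ (inj₂ z≡q) = x≢z (trans x≡q (sym z≡q))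
three-distinct-not-in-pair _ _ y≢z _ (inj₁ y≡p) (inj₁ z≡p) = y≢z (trans y≡p (sym z≡p))
three-distinct-not-in-pair _ _ y≢z _ (inj₂ y≡q) (inj₂ z≡q) = y≢z (trans y≡q (sym z≡q))

↔-to≡⇒≡from : (M : Vec Bool n ↔ Vec Bool n) {x v : Vec Bool n} →
              Inverse.to M x ≡ v → x ≡ Inverse.from M v
↔-to≡⇒≡from M {x} to-x≡v = trans (sym (Inverse.strictlyInverseʳ M x)) (cong (Inverse.from M) to-x≡v)

glue-cross-neighbour : {G₁ G₂ : Graph n} (M₁ M₂ : Vec Bool n ↔ Vec Bool n) {x v : Vec Bool n} →
                       glue G₁ G₂ M₁ M₂ (false ∷ x) (true ∷ v) →
                       x ≡ Inverse.from M₁ v ⊎ x ≡ Inverse.from M₂ v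
glue-cross-neighbour M₁ M₂ (inj₁ e) = inj₁ (↔-to≡⇒≡from M₁ e)
glue-cross-neighbour M₁ M₂ (inj₂ e) = inj₂ (↔-to≡⇒≡from M₂ e)

TwoNeighbours : Graph n → Vec Bool n → Set
TwoNeighbours G u = ∃₂ λ y z → G u y × G u z × y ≢ z

glue-cross-¬Twins : {G₁ G₂ : Graph n} (M₁ M₂ : Vec Bool n ↔ Vec Bool n) {u v : Vec Bool n} →
                    TwoNeighbours G₁ u → glue G₁ G₂ M₁ M₂ (false ∷ u) (true ∷ v) →
                    ¬ Twins (glue G₁ G₂ M₁ M₂) (false ∷ u) (true ∷ v)
glue-cross-¬Twins {G₁ = G₁} {G₂} M₁ M₂ {u} {v} (y , z , uy , uz , y≢z) uv twins =
  let vy , y≢u = shared uy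
      vz , z≢u = shared uz
  in  three-distinct-not-in-pair (y≢u ∘ sym) (z≢u ∘ sym) y≢z (cross uv) (cross vy) (cross vz)
  where
  shared : ∀ {w} → G₁ u w → glue G₁ G₂ M₁ M₂ (true ∷ v) (false ∷ w) × w ≢ u
  shared {w} uw = map₂ (_∘ cong (false ∷_)) (Equivalence.to (twins (false ∷ w)) (uw , λ ()))
  cross : ∀ {x} → glue G₁ G₂ M₁ M₂ (false ∷ x) (true ∷ v) →
          x ≡ Inverse.from M₁ v ⊎ x ≡ Inverse.from M₂ v
  cross = glue-cross-neighbour {G₁ = G₁} {G₂} M₁ M₂

≢map-not : (w : Vec Bool (suc n)) → w ≢ map not w
≢map-not (b ∷ _) = Bool.not-¬ refl ∘ ∷-injectiveˡ

map-not-involutive : (w : Vec Bool n) → map not (map not w) ≡ w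
map-not-involutive w = begin
  map not (map not w)  ≡⟨ map-∘ not not w ⟨
  map (not ∘ not) w    ≡⟨ map-cong Bool.not-involutive w ⟩
  map id w             ≡⟨ map-id w ⟩
  w                    ∎
  where open ≡-Reasoning

AQ-two-neighbours : ∀ n (c : Bool) (w : Vec Bool (suc n)) → TwoNeighbours (AQ (suc (suc n))) (c ∷ w)
AQ-two-neighbours n c w = not c ∷ w , not c ∷ map not w , edge c , complement c , ≢map-not w ∘ ∷-injectiveʳ
  where
  edge : ∀ c → AQ (suc (suc n)) (c ∷ w) (not c ∷ w)
  edge false = inj₁ refl
  edge true  = inj₁ refl
  complement : ∀ c → AQ (suc (suc n)) (c ∷ w) (not c ∷ map not w)
  complement false = inj₂ (sym (map-not-involutive w))
  complement true  = inj₂ (sym (map-not-involutive w))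

IsGAQ⇒two-neighbours : {G : Graph n} → IsGAQ n G → ∀ u → TwoNeighbours G u
IsGAQ⇒two-neighbours base (c ∷ w) = AQ-two-neighbours 2 c w
IsGAQ⇒two-neighbours (step g₁ _ _ _ _) (false ∷ u) with IsGAQ⇒two-neighbours g₁ u
... | y , z , uy , uz , y≢z = false ∷ y , false ∷ z , uy , uz , y≢z ∘ ∷-injectiveʳ
IsGAQ⇒two-neighbours (step _ g₂ _ _ _) (true ∷ u) with IsGAQ⇒two-neighbours g₂ u
... | y , z , uy , uz , y≢z = true ∷ y , true ∷ z , uy , uz , y≢z ∘ ∷-injectiveʳ

all? : {p : Level} {P : Pred (Vec Bool n) p} → Decidable P → Dec (∀ v → P v)
all? {zero}  P? = map′ (λ { p [] → p }) (λ h → h []) (P? [])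
all? {suc n} P? = map′ (λ { (f , t) (false ∷ v) → f v ; (f , t) (true ∷ v) → t v })
                       (λ h → h ∘ (false ∷_) , h ∘ (true ∷_))
                       (all? (P? ∘ (false ∷_)) ×-dec all? (P? ∘ (true ∷_)))

any? : {p : Level} {P : Pred (Vec Bool n) p} → Decidable P → Dec (∃ P)
any? {zero}  P? = map′ ([] ,_) (λ { ([] , p) → p }) (P? [])
any? {suc n} P? = map′ (λ { (inj₁ (v , p)) → false ∷ v , p ; (inj₂ (v , p)) → true ∷ v , p })
                       (λ { (false ∷ v , p) → inj₁ (v , p) ; (true ∷ v , p) → inj₂ (v , p) })
                       (any? (P? ∘ (false ∷_)) ⊎-dec any? (P? ∘ (true ∷_)))

AQ? : ∀ n u v → Dec (AQ n u v)
AQ? zero          []          []          = no λ ()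
AQ? (suc zero)    (x ∷ [])    (y ∷ [])    = ¬? (x Bool.≟ y)
AQ? (suc (suc n)) (false ∷ u) (false ∷ v) = AQ? (suc n) u v
AQ? (suc (suc n)) (true  ∷ u) (true  ∷ v) = AQ? (suc n) u v
AQ? (suc (suc n)) (false ∷ u) (true  ∷ v) = ≡-dec Bool._≟_ u v ⊎-dec ≡-dec Bool._≟_ u (map not v)
AQ? (suc (suc n)) (true  ∷ u) (false ∷ v) = ≡-dec Bool._≟_ u v ⊎-dec ≡-dec Bool._≟_ u (map not v)

AQ₄-distinguishing-neighbour : ∀ a b → AQ 4 a b → ∃ λ x → AQ 4 a x × x ≢ b × ¬ AQ 4 b x
AQ₄-distinguishing-neighbour = toWitness {a? = decision} _
  where
  decision : Dec (∀ a b → AQ 4 a b → ∃ λ x → AQ 4 a x × x ≢ b × ¬ AQ 4 b x)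
  decision = all? λ a → all? λ b → AQ? 4 a b →-dec any? λ x →
               AQ? 4 a x ×-dec ¬? (≡-dec Bool._≟_ x b) ×-dec ¬? (AQ? 4 b x)

lemma3p1 : (n : ℕ) (G : Graph n) → IsGAQ n G →
           (a b : Vec Bool n) → G a b →
           ¬ (∀ x → (G a x × x ≢ b) ⇔ (G b x × x ≢ a))
lemma3p1 _ _ base a b ab = distinguishing-neighbour⇒¬Twins (AQ₄-distinguishing-neighbour a b ab)
lemma3p1 (suc n) G (step g₁ _ _ _ _) (false ∷ u) (false ∷ v) ab =
  lemma3p1 n _ g₁ u v ab ∘ Twins-copy G false
lemma3p1 (suc n) G (step _ g₂ _ _ _) (true ∷ u) (true ∷ v) ab =
  lemma3p1 n _ g₂ u v ab ∘ Twins-copy G true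
lemma3p1 _ _ (step g₁ _ M₁ M₂ _) (false ∷ u) (true ∷ v) ab =
  glue-cross-¬Twins M₁ M₂ (IsGAQ⇒two-neighbours g₁ u) ab
lemma3p1 _ G (step g₁ _ M₁ M₂ _) (true ∷ u) (false ∷ v) ab =
  glue-cross-¬Twins M₁ M₂ (IsGAQ⇒two-neighbours g₁ v) ab ∘ Twins-sym {G = G}
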